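{- Let $n\in\mathbb{N}_0$. Then \[ \sum_{k=0}^{n}(-1)^{k}\int_{\mathbb{Z}_p}\mathfrak{b}_k^n(x)\,d\mu_{ -1}(x)=\sum_{j=0}^{n}\binom{n}{j}(-2)^{n-j}E_{n-j}. \]
   Context: $p$ is an odd prime. For a polynomial $f:\mathbb{Z}_p\to\mathbb{C}_p$ the fermionic $p$-adic integral is $\int_{\mathbb{Z}_p} f(x)\,d\mu_{ -1}(x)=\lim_{N\to\infty}\sum_{x=0}^{p^N-1}(-1)^xf(x)$. The Bernstein basis polynomials are $\mathfrak{b}_k^n(x)=\binom{n}{k}x^k(1-x)^{n-k}$ for $0\le k\le n$. The Euler numbers $E_m$ are defined by $\frac{2}{e^t+1}=\sum_{m\ge0}E_m\frac{t^m}{m!}$. -}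

module Defs where

open import Data.Nat as ℕ using (ℕ; zero; suc; _≤_)
open import Data.Nat.Combinatorics using (_C_)
open import Data.Nat.Primality using (Prime)
open import Data.Integer as ℤ using (ℤ; +_)
open import Data.Integer.Divisibility as ℤD using ()
open import Data.Rational as ℚ using (ℚ; 0ℚ; 1ℚ; _+_; _*_; _-_; -_)
open import Data.Product using (Σ; ∃; ∃-syntax; _×_)
open import Relation.Binary.PropositionalEquality using (_≡_)
open import Relation.Nullary using (¬_)

ℕ→ℚ : ℕ → ℚ
ℕ→ℚ n = ℚ._/_ (+ n) 1

_^ℚ_ : ℚ → ℕ → ℚ
q ^ℚ zero = 1ℚ
q ^ℚ suc m = q * (q ^ℚ m)

sumBelow : ℕ → (ℕ → ℚ) → ℚ
sumBelow zero f = 0ℚ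
sumBelow (suc n) f = sumBelow n f + f n

sumTo : ℕ → (ℕ → ℚ) → ℚ
sumTo n f = sumBelow (suc n) f

sgn : ℕ → ℚ
sgn k = (- 1ℚ) ^ℚ k

-- p-adic closeness: v_p(q) ≥ M, i.e. q·b = p^M·a with a,b ∈ ℤ and p ∤ b
PAdicSmall : ℕ → ℕ → ℚ → Set
PAdicSmall p M q =
  ∃[ a ] ∃[ b ] (¬ ((+ p) ℤD.∣ b) × (q * ℚ._/_ b 1 ≡ ℚ._/_ (+ (p ℕ.^ M)) 1 * ℚ._/_ a 1))

PAdicLimit : ℕ → (ℕ → ℚ) → ℚ → Set
PAdicLimit p s L = ∀ (M : ℕ) → ∃[ N₀ ] (∀ N → N₀ ≤ N → PAdicSmall p M (s N - L))

-- ∫_{ℤ_p} f dμ_{-1} = L  :  lim_N Σ_{x=0}^{p^N-1} (-1)^x f(x) = L  (p-adically)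
FermionicIntegral : ℕ → (ℕ → ℚ) → ℚ → Set
FermionicIntegral p f L = PAdicLimit p (λ N → sumBelow (p ℕ.^ N) (λ x → sgn x * f x)) L

bernstein : ℕ → ℕ → ℚ → ℚ
bernstein k n x = ℕ→ℚ (n C k) * (x ^ℚ k) * ((1ℚ - x) ^ℚ (n ℕ.∸ k))

-- E is the sequence of Euler numbers: coefficient comparison in
-- (e^t + 1) · Σ_m E_m t^m/m! = 2, i.e. Σ_{j=0}^m C(m,j) E_j + E_m = 2·[m = 0]
IsEulerNumbers : (ℕ → ℚ) → Set
IsEulerNumbers E =
  (E 0 + E 0 ≡ ℚ._/_ (+ 2) 1) ×
  (∀ m → sumTo (suc m) (λ j → ℕ→ℚ (suc m C j) * E j) + E (suc m) ≡ 0ℚ)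

{-# OPTIONS --safe #-}
module Submission where

-- For odd L write S_L(f) = Σ_{x<L} (-1)^x f(x). The sum S_L((x+1)^m + x^m) telescopes to
-- 0^m + L^m, and expanding (x+1)^m shows that the moments S_L(x^j) satisfy the recurrence
-- defining the Euler numbers up to the error term L^m. Induction on m then gives
-- 2^(m+1) (S_L(x^m) - E_m) ∈ Lℤ for every odd L, so with L = p^N the monomial x^m has
-- fermionic integral E_m, and by linearity every Bernstein polynomial has an integral.
-- Such values are unique, since a rational number that some fixed power of 2 carries into
-- Lℤ for every odd L is 0. The identity follows by integrating
-- Σ_k (-1)^k b_k^n(x) = (1 - 2x)^n = Σ_j C(n,j) (-2)^(n-j) x^(n-j) term by term on both sides.

open import Defs
open import Data.Nat using (ℕ; _∸_; _≤_)
open import Data.Nat.Combinatorics using (_C_)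
open import Data.Nat.Primality using (Prime)
open import Data.Rational using (ℚ; _*_; -_; 1ℚ; _+_)
open import Data.Product using (Σ; _×_)
open import Relation.Binary.PropositionalEquality using (_≡_; _≢_)

open import Algebra.Bundles using (CommutativeSemiring; CommutativeRing)
open import Data.Empty using (⊥-elim)
open import Data.Fin.Base using (toℕ)
open import Data.Integer as ℤ using (ℤ; +_)
import Data.Integer.Properties as ℤP
open import Data.Nat as ℕ using (zero; suc; _<_; _≤′_; ≤′-refl; ≤′-step; s≤s)
import Data.Nat.Coprimality as Coprime
open import Data.Nat.Coprimality using (prime⇒coprime)
open import Data.Nat.Combinatorics using (nCn≡1)
open import Data.Nat.Divisibility as ℕD using (divides)
open import Data.Nat.Primality using (prime⇒irreducible; prime⇒nonTrivial)
import Data.Nat.Properties as ℕP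
import Data.Nat.Tactic.RingSolver as ℕSolver
open import Data.Product using (∃-syntax; _,_; proj₁; proj₂)
open import Data.Rational as ℚ using (mkℚ; 0ℚ; _-_; ½)
import Data.Rational.Properties as ℚP
open import Algebra.Properties.Group ℚP.+-0-group using () renaming (x∙y⁻¹≈ε⇒x≈y to x-y≡0⇒x≡y)
open import Data.Sum using (_⊎_; inj₁; inj₂)
open import Function using (_∘_)
open import Level using (0ℓ)
open import Relation.Binary.PropositionalEquality
  using (refl; sym; trans; cong; cong₂; subst; _≗_; module ≡-Reasoning)
open import Relation.Nullary using (¬_)
open import Relation.Nullary.Decidable using (dec⇒maybe)
open import Tactic.RingSolver using (solve-∀)
open import Tactic.RingSolver.Core.AlmostCommutativeRing
  using (AlmostCommutativeRing; fromCommutativeRing)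

ℚ-ring : AlmostCommutativeRing 0ℓ 0ℓ
ℚ-ring = fromCommutativeRing ℚP.+-*-commutativeRing (λ x → dec⇒maybe (0ℚ ℚP.≟ x))

ℚ-commutativeSemiring : CommutativeSemiring 0ℓ 0ℓ
ℚ-commutativeSemiring = CommutativeRing.commutativeSemiring ℚP.+-*-commutativeRing

open CommutativeSemiring ℚ-commutativeSemiring using (semiring)
open import Algebra.Properties.Semiring.Exp semiring using () renaming (_^_ to _^ˢ_)
open import Algebra.Properties.Semiring.Mult semiring using () renaming (_×_ to _×ˢ_)
open import Algebra.Properties.Semiring.Sum semiring using (sum)
import Algebra.Properties.Semiring.Exp semiring as Exp
import Algebra.Properties.CommutativeSemiring.Exp ℚ-commutativeSemiring as CommExp
import Algebra.Properties.CommutativeSemiring.Binomial ℚ-commutativeSemiring as Binomial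

fromℤ : ℤ → ℚ
fromℤ a = ℚ._/_ a 1

fromℤ≡mkℚ : ∀ a → fromℤ a ≡ mkℚ a 0 (Coprime.sym (Coprime.1-coprimeTo ℤ.∣ a ∣))
fromℤ≡mkℚ a = ℚP.↥p/↧p≡p (mkℚ a 0 (Coprime.sym (Coprime.1-coprimeTo ℤ.∣ a ∣)))

-- On canonical forms, _*_ computes to (a ℤ.* b) / (1 * 1), which is fromℤ (a ℤ.* b).
fromℤ-homo-* : ∀ a b → fromℤ a * fromℤ b ≡ fromℤ (a ℤ.* b)
fromℤ-homo-* a b = cong₂ _*_ (fromℤ≡mkℚ a) (fromℤ≡mkℚ b)

fromℤ-homo-+ : ∀ a b → fromℤ a + fromℤ b ≡ fromℤ (a ℤ.+ b)
fromℤ-homo-+ a b = trans (cong₂ _+_ (fromℤ≡mkℚ a) (fromℤ≡mkℚ b))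
  (ℚP./-cong (cong₂ ℤ._+_ (ℤP.*-identityʳ a) (ℤP.*-identityʳ b)) refl)

fromℤ-homo‿- : ∀ a → - fromℤ a ≡ fromℤ (ℤ.- a)
fromℤ-homo‿- a = trans (cong -_ (fromℤ≡mkℚ a)) (trans (neg-mkℚ a) (sym (fromℤ≡mkℚ (ℤ.- a))))
  where
  neg-mkℚ : ∀ a .{c : Coprime.Coprime ℤ.∣ a ∣ 1} .{c′ : Coprime.Coprime ℤ.∣ ℤ.- a ∣ 1} →
    - mkℚ a 0 c ≡ mkℚ (ℤ.- a) 0 c′
  neg-mkℚ (+ zero) = refl
  neg-mkℚ (+ suc n) = refl
  neg-mkℚ ℤ.-[1+ n ] = refl

fromℤ-injective : ∀ {a b} → fromℤ a ≡ fromℤ b → a ≡ b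
fromℤ-injective {a} {b} eq =
  trans (cong ℚ.↥_ (sym (fromℤ≡mkℚ a))) (trans (cong ℚ.↥_ eq) (cong ℚ.↥_ (fromℤ≡mkℚ b)))

IsInteger : ℚ → Set
IsInteger q = ∃[ a ] q ≡ fromℤ a

isInteger-* : ∀ {x y} → IsInteger x → IsInteger y → IsInteger (x * y)
isInteger-* (a , refl) (b , refl) = a ℤ.* b , fromℤ-homo-* a b

isInteger‿- : ∀ {x} → IsInteger x → IsInteger (- x)
isInteger‿- (a , refl) = ℤ.- a , fromℤ-homo‿- a

isInteger-ℕ : ∀ n → IsInteger (ℕ→ℚ n)
isInteger-ℕ n = + n , refl

isInteger-^ : ∀ {x} → IsInteger x → ∀ k → IsInteger (x ^ℚ k)
isInteger-^ x∈ℤ zero = isInteger-ℕ 1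
isInteger-^ x∈ℤ (suc k) = isInteger-* x∈ℤ (isInteger-^ x∈ℤ k)

isInteger-sgn : ∀ k → IsInteger (sgn k)
isInteger-sgn = isInteger-^ (isInteger‿- (isInteger-ℕ 1))

ℕ→ℚ-homo-+ : ∀ m n → ℕ→ℚ (m ℕ.+ n) ≡ ℕ→ℚ m + ℕ→ℚ n
ℕ→ℚ-homo-+ m n = sym (trans (fromℤ-homo-+ (+ m) (+ n)) (cong fromℤ (sym (ℤP.pos-+ m n))))

ℕ→ℚ-homo-* : ∀ m n → ℕ→ℚ (m ℕ.* n) ≡ ℕ→ℚ m * ℕ→ℚ n
ℕ→ℚ-homo-* m n = sym (trans (fromℤ-homo-* (+ m) (+ n)) (cong fromℤ (sym (ℤP.pos-* m n))))

ℕ→ℚ-suc : ∀ n → ℕ→ℚ (suc n) ≡ ℕ→ℚ n + 1ℚ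
ℕ→ℚ-suc n = trans (cong ℕ→ℚ (ℕP.+-comm 1 n)) (ℕ→ℚ-homo-+ n 1)

ℕ→ℚ-homo-^ : ∀ m k → ℕ→ℚ (m ℕ.^ k) ≡ ℕ→ℚ m ^ℚ k
ℕ→ℚ-homo-^ m zero = refl
ℕ→ℚ-homo-^ m (suc k) = trans (ℕ→ℚ-homo-* m (m ℕ.^ k)) (cong (ℕ→ℚ m *_) (ℕ→ℚ-homo-^ m k))

^ˢ≡^ℚ : ∀ x n → x ^ˢ n ≡ x ^ℚ n
^ˢ≡^ℚ x zero = refl
^ˢ≡^ℚ x (suc n) = cong (x *_) (^ˢ≡^ℚ x n)

×ˢ≡ℕ→ℚ* : ∀ n x → n ×ˢ x ≡ ℕ→ℚ n * x
×ˢ≡ℕ→ℚ* zero x = sym (ℚP.*-zeroˡ x)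
×ˢ≡ℕ→ℚ* (suc n) x = trans (cong (_+_ x) (×ˢ≡ℕ→ℚ* n x))
  (trans (add-one (ℕ→ℚ n) x) (cong (_* x) (sym (ℕ→ℚ-suc n))))
  where
  add-one : ∀ c x → x + c * x ≡ (c + 1ℚ) * x
  add-one = solve-∀ ℚ-ring

^ℚ-distribˡ-+-* : ∀ x m n → x ^ℚ (m ℕ.+ n) ≡ x ^ℚ m * x ^ℚ n
^ℚ-distribˡ-+-* x m n = trans (sym (^ˢ≡^ℚ x (m ℕ.+ n)))
  (trans (Exp.^-homo-* x m n) (cong₂ _*_ (^ˢ≡^ℚ x m) (^ˢ≡^ℚ x n)))

^ℚ-distribʳ-* : ∀ x y n → (x * y) ^ℚ n ≡ x ^ℚ n * y ^ℚ n
^ℚ-distribʳ-* x y n = trans (sym (^ˢ≡^ℚ (x * y) n))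
  (trans (CommExp.^-distrib-* x y n) (cong₂ _*_ (^ˢ≡^ℚ x n) (^ˢ≡^ℚ y n)))

^ℚ-zeroˡ : ∀ n → 1ℚ ^ℚ n ≡ 1ℚ
^ℚ-zeroˡ zero = refl
^ℚ-zeroˡ (suc n) = trans (ℚP.*-identityˡ _) (^ℚ-zeroˡ n)

neg-^ℚ : ∀ x n → (- x) ^ℚ n ≡ sgn n * x ^ℚ n
neg-^ℚ x n = trans (cong (_^ℚ n) (neg≡-1* x)) (^ℚ-distribʳ-* (- 1ℚ) x n)
  where
  neg≡-1* : ∀ x → - x ≡ (- 1ℚ) * x
  neg≡-1* = solve-∀ ℚ-ring

sgn-odd : ∀ t → sgn (suc (t ℕ.* 2)) ≡ - 1ℚ
sgn-odd zero = refl
sgn-odd (suc t) = trans (square-cancel (sgn (suc (t ℕ.* 2)))) (sgn-odd t)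
  where
  square-cancel : ∀ s → (- 1ℚ) * ((- 1ℚ) * s) ≡ s
  square-cancel = solve-∀ ℚ-ring

sumBelow-cong : ∀ n {f g : ℕ → ℚ} → f ≗ g → sumBelow n f ≡ sumBelow n g
sumBelow-cong zero f≗g = refl
sumBelow-cong (suc n) f≗g = cong₂ _+_ (sumBelow-cong n f≗g) (f≗g n)

sumBelow-0 : ∀ n → sumBelow n (λ _ → 0ℚ) ≡ 0ℚ
sumBelow-0 zero = refl
sumBelow-0 (suc n) = trans (ℚP.+-identityʳ _) (sumBelow-0 n)

sumBelow-+ : ∀ n (f g : ℕ → ℚ) → sumBelow n (λ x → f x + g x) ≡ sumBelow n f + sumBelow n g
sumBelow-+ zero f g = refl
sumBelow-+ (suc n) f g =
  trans (cong (_+ (f n + g n)) (sumBelow-+ n f g)) (interchange (sumBelow n f) (sumBelow n g) (f n) (g n))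
  where
  interchange : ∀ a b c d → (a + b) + (c + d) ≡ (a + c) + (b + d)
  interchange = solve-∀ ℚ-ring

sumBelow-* : ∀ n c (f : ℕ → ℚ) → sumBelow n (λ x → c * f x) ≡ c * sumBelow n f
sumBelow-* zero c f = sym (ℚP.*-zeroʳ c)
sumBelow-* (suc n) c f = trans (cong (_+ (c * f n)) (sumBelow-* n c f)) (sym (ℚP.*-distribˡ-+ c _ _))

sumBelow-sub : ∀ n (f g : ℕ → ℚ) → sumBelow n (λ x → f x - g x) ≡ sumBelow n f - sumBelow n g
sumBelow-sub zero f g = refl
sumBelow-sub (suc n) f g =
  trans (cong (_+ (f n - g n)) (sumBelow-sub n f g)) (interchange (sumBelow n f) (sumBelow n g) (f n) (g n))
  where
  interchange : ∀ a b c d → (a - b) + (c - d) ≡ (a + c) - (b + d)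
  interchange = solve-∀ ℚ-ring

sumBelow-swap : ∀ n m (h : ℕ → ℕ → ℚ) →
  sumBelow n (λ x → sumBelow m (h x)) ≡ sumBelow m (λ j → sumBelow n (λ x → h x j))
sumBelow-swap zero m h = sym (sumBelow-0 m)
sumBelow-swap (suc n) m h = trans (cong (_+ sumBelow m (h n)) (sumBelow-swap n m h))
  (sym (sumBelow-+ m (λ j → sumBelow n (λ x → h x j)) (h n)))

sumBelow-shift : ∀ n (f : ℕ → ℚ) → sumBelow (suc n) f ≡ f 0 + sumBelow n (f ∘ suc)
sumBelow-shift zero f = trans (ℚP.+-identityˡ (f 0)) (sym (ℚP.+-identityʳ (f 0)))
sumBelow-shift (suc n) f = trans (cong (_+ f (suc n)) (sumBelow-shift n f)) (ℚP.+-assoc (f 0) _ _)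

sumBelow≡sum : ∀ n (f : ℕ → ℚ) → sumBelow n f ≡ sum {n} (f ∘ toℕ)
sumBelow≡sum zero f = refl
sumBelow≡sum (suc n) f = trans (sumBelow-shift n f) (cong (_+_ (f 0)) (sumBelow≡sum n (f ∘ suc)))

binomial : ∀ a b n → (a + b) ^ℚ n ≡ sumTo n (λ k → ℕ→ℚ (n C k) * a ^ℚ k * b ^ℚ (n ∸ k))
binomial a b n = begin
  (a + b) ^ℚ n                                             ≡⟨ sym (^ˢ≡^ℚ (a + b) n) ⟩
  (a + b) ^ˢ n                                             ≡⟨ Binomial.theorem n a b ⟩
  sum {suc n} (λ k → (n C toℕ k) ×ˢ (a ^ˢ toℕ k * b ^ˢ (n ∸ toℕ k)))  ≡⟨ sym (sumBelow≡sum (suc n) _) ⟩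
  sumTo n (λ k → (n C k) ×ˢ (a ^ˢ k * b ^ˢ (n ∸ k)))          ≡⟨ sumBelow-cong (suc n) term ⟩
  sumTo n (λ k → ℕ→ℚ (n C k) * a ^ℚ k * b ^ℚ (n ∸ k))        ∎
  where
  open ≡-Reasoning
  term : ∀ k → (n C k) ×ˢ (a ^ˢ k * b ^ˢ (n ∸ k)) ≡ ℕ→ℚ (n C k) * a ^ℚ k * b ^ℚ (n ∸ k)
  term k = trans (×ˢ≡ℕ→ℚ* (n C k) _)
    (trans (cong₂ (λ u v → ℕ→ℚ (n C k) * (u * v)) (^ˢ≡^ℚ a k) (^ˢ≡^ℚ b (n ∸ k)))
      (sym (ℚP.*-assoc (ℕ→ℚ (n C k)) (a ^ℚ k) (b ^ℚ (n ∸ k)))))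

altSum : (ℕ → ℚ) → ℕ → ℚ
altSum f L = sumBelow L (λ x → sgn x * f x)

altSum-cong : ∀ {f g} → f ≗ g → ∀ L → altSum f L ≡ altSum g L
altSum-cong f≗g L = sumBelow-cong L (λ x → cong (sgn x *_) (f≗g x))

altSum-+ : ∀ f g L → altSum (λ x → f x + g x) L ≡ altSum f L + altSum g L
altSum-+ f g L = trans (sumBelow-cong L (λ x → ℚP.*-distribˡ-+ (sgn x) (f x) (g x)))
  (sumBelow-+ L (λ x → sgn x * f x) (λ x → sgn x * g x))

altSum-* : ∀ c f L → altSum (λ x → c * f x) L ≡ c * altSum f L
altSum-* c f L = trans (sumBelow-cong L (λ x → swap (sgn x) c (f x))) (sumBelow-* L c (λ x → sgn x * f x))
  where
  swap : ∀ s c y → s * (c * y) ≡ c * (s * y)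
  swap = solve-∀ ℚ-ring

altSum-telescope : ∀ (g : ℕ → ℚ) L → altSum (λ x → g (suc x) + g x) L ≡ g 0 - sgn L * g L
altSum-telescope g zero = base (g 0)
  where
  base : ∀ z → 0ℚ ≡ z - 1ℚ * z
  base = solve-∀ ℚ-ring
altSum-telescope g (suc L) =
  trans (cong (_+ (sgn L * (g (suc L) + g L))) (altSum-telescope g L)) (step (g 0) (sgn L) (g (suc L)) (g L))
  where
  step : ∀ z s a b → (z - s * b) + s * (a + b) ≡ z - ((- 1ℚ) * s) * a
  step = solve-∀ ℚ-ring

altPowerSum : ℕ → ℕ → ℚ
altPowerSum L j = altSum (λ x → ℕ→ℚ x ^ℚ j) L

altSum-binomial : ∀ L m →
  altSum (λ x → (ℕ→ℚ x + 1ℚ) ^ℚ m) L ≡ sumTo m (λ j → ℕ→ℚ (m C j) * altPowerSum L j)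
altSum-binomial L m = begin
  altSum (λ x → (ℕ→ℚ x + 1ℚ) ^ℚ m) L
    ≡⟨ altSum-cong (λ x → trans (binomial (ℕ→ℚ x) 1ℚ m) (sumBelow-cong (suc m) (drop-1^ (ℕ→ℚ x)))) L ⟩
  sumBelow L (λ x → sgn x * sumTo m (λ j → ℕ→ℚ (m C j) * ℕ→ℚ x ^ℚ j))
    ≡⟨ sumBelow-cong L (λ x → sym (sumBelow-* (suc m) (sgn x) _)) ⟩
  sumBelow L (λ x → sumTo m (λ j → sgn x * (ℕ→ℚ (m C j) * ℕ→ℚ x ^ℚ j)))
    ≡⟨ sumBelow-swap L (suc m) _ ⟩
  sumTo m (λ j → sumBelow L (λ x → sgn x * (ℕ→ℚ (m C j) * ℕ→ℚ x ^ℚ j)))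
    ≡⟨ sumBelow-cong (suc m) (λ j → altSum-* (ℕ→ℚ (m C j)) (λ x → ℕ→ℚ x ^ℚ j) L) ⟩
  sumTo m (λ j → ℕ→ℚ (m C j) * altPowerSum L j) ∎
  where
  open ≡-Reasoning
  drop-1^ : ∀ y j → ℕ→ℚ (m C j) * y ^ℚ j * 1ℚ ^ℚ (m ∸ j) ≡ ℕ→ℚ (m C j) * y ^ℚ j
  drop-1^ y j = trans (cong (ℕ→ℚ (m C j) * y ^ℚ j *_) (^ℚ-zeroˡ (m ∸ j))) (ℚP.*-identityʳ _)

-- IsEulerNumbers E says exactly that eulerTransform E m = 2·[m = 0].
eulerTransform : (ℕ → ℚ) → ℕ → ℚ
eulerTransform a m = sumTo m (λ j → ℕ→ℚ (m C j) * a j) + a m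

eulerTransform-sub : ∀ a b m → eulerTransform (λ j → a j - b j) m ≡ eulerTransform a m - eulerTransform b m
eulerTransform-sub a b m =
  trans (cong (_+ (a m - b m)) weighted-sub) (interchange (weighted a) (weighted b) (a m) (b m))
  where
  weighted : (ℕ → ℚ) → ℚ
  weighted c = sumTo m (λ j → ℕ→ℚ (m C j) * c j)
  distrib : ∀ c x y → c * (x - y) ≡ c * x - c * y
  distrib = solve-∀ ℚ-ring
  weighted-sub : weighted (λ j → a j - b j) ≡ weighted a - weighted b
  weighted-sub = trans (sumBelow-cong (suc m) (λ j → distrib (ℕ→ℚ (m C j)) (a j) (b j)))
    (sumBelow-sub (suc m) (λ j → ℕ→ℚ (m C j) * a j) (λ j → ℕ→ℚ (m C j) * b j))
  interchange : ∀ s t x y → (s - t) + (x - y) ≡ (s + x) - (t + y)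
  interchange = solve-∀ ℚ-ring

eulerTransform-top : ∀ a m → eulerTransform a m ≡ sumBelow m (λ j → ℕ→ℚ (m C j) * a j) + a m * ℕ→ℚ 2
eulerTransform-top a m =
  trans (cong (λ c → s + ℕ→ℚ c * a m + a m) (nCn≡1 m)) (regroup s (a m))
  where
  s = sumBelow m (λ j → ℕ→ℚ (m C j) * a j)
  regroup : ∀ s x → s + 1ℚ * x + x ≡ s + x * (1ℚ + 1ℚ)
  regroup = solve-∀ ℚ-ring

eulerTransform-altPowerSum : ∀ t m →
  eulerTransform (altPowerSum (suc (t ℕ.* 2))) m ≡ 0ℚ ^ℚ m + ℕ→ℚ (suc (t ℕ.* 2)) ^ℚ m
eulerTransform-altPowerSum t m = begin
  eulerTransform (altPowerSum L) m
    ≡⟨ cong (_+ altPowerSum L m) (sym (altSum-binomial L m)) ⟩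
  altSum (λ x → (ℕ→ℚ x + 1ℚ) ^ℚ m) L + altPowerSum L m
    ≡⟨ sym (altSum-+ (λ x → (ℕ→ℚ x + 1ℚ) ^ℚ m) (λ x → ℕ→ℚ x ^ℚ m) L) ⟩
  altSum (λ x → (ℕ→ℚ x + 1ℚ) ^ℚ m + ℕ→ℚ x ^ℚ m) L
    ≡⟨ altSum-cong (λ x → cong (λ y → y ^ℚ m + ℕ→ℚ x ^ℚ m) (sym (ℕ→ℚ-suc x))) L ⟩
  altSum (λ x → ℕ→ℚ (suc x) ^ℚ m + ℕ→ℚ x ^ℚ m) L
    ≡⟨ altSum-telescope (λ x → ℕ→ℚ x ^ℚ m) L ⟩
  0ℚ ^ℚ m - sgn L * ℕ→ℚ L ^ℚ m
    ≡⟨ cong (λ s → 0ℚ ^ℚ m - s * ℕ→ℚ L ^ℚ m) (sgn-odd t) ⟩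
  0ℚ ^ℚ m - (- 1ℚ) * ℕ→ℚ L ^ℚ m
    ≡⟨ sub-neg (0ℚ ^ℚ m) (ℕ→ℚ L ^ℚ m) ⟩
  0ℚ ^ℚ m + ℕ→ℚ L ^ℚ m ∎
  where
  open ≡-Reasoning
  L = suc (t ℕ.* 2)
  sub-neg : ∀ z y → z - (- 1ℚ) * y ≡ z + y
  sub-neg = solve-∀ ℚ-ring

-- Divisibility by L after clearing a power of 2

infix 4 _∣[2^_]_

record _∣[2^_]_ (L k : ℕ) (q : ℚ) : Set where
  constructor multiple
  field
    quotient : ℤ
    equality : q * ℕ→ℚ 2 ^ℚ k ≡ ℕ→ℚ L * fromℤ quotient

module _ {L k : ℕ} where

  ∣[2^]-0 : L ∣[2^ k ] 0ℚ
  ∣[2^]-0 = multiple (+ 0) (trans (ℚP.*-zeroˡ (ℕ→ℚ 2 ^ℚ k)) (sym (ℚP.*-zeroʳ (ℕ→ℚ L))))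

  ∣[2^]-+ : ∀ {q r} → L ∣[2^ k ] q → L ∣[2^ k ] r → L ∣[2^ k ] (q + r)
  ∣[2^]-+ {q} {r} (multiple z q≡) (multiple w r≡) = multiple (z ℤ.+ w) (begin
    (q + r) * ℕ→ℚ 2 ^ℚ k                       ≡⟨ ℚP.*-distribʳ-+ _ q r ⟩
    q * ℕ→ℚ 2 ^ℚ k + r * ℕ→ℚ 2 ^ℚ k            ≡⟨ cong₂ _+_ q≡ r≡ ⟩
    ℕ→ℚ L * fromℤ z + ℕ→ℚ L * fromℤ w          ≡⟨ sym (ℚP.*-distribˡ-+ (ℕ→ℚ L) _ _) ⟩
    ℕ→ℚ L * (fromℤ z + fromℤ w)                ≡⟨ cong (ℕ→ℚ L *_) (fromℤ-homo-+ z w) ⟩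
    ℕ→ℚ L * fromℤ (z ℤ.+ w)                    ∎)
    where open ≡-Reasoning

  ∣[2^]-* : ∀ {c q} → IsInteger c → L ∣[2^ k ] q → L ∣[2^ k ] (c * q)
  ∣[2^]-* {q = q} (a , refl) (multiple z q≡) = multiple (a ℤ.* z) (begin
    fromℤ a * q * ℕ→ℚ 2 ^ℚ k                    ≡⟨ ℚP.*-assoc (fromℤ a) q _ ⟩
    fromℤ a * (q * ℕ→ℚ 2 ^ℚ k)                  ≡⟨ cong (fromℤ a *_) q≡ ⟩
    fromℤ a * (ℕ→ℚ L * fromℤ z)                 ≡⟨ swap (fromℤ a) (ℕ→ℚ L) (fromℤ z) ⟩
    ℕ→ℚ L * (fromℤ a * fromℤ z)                 ≡⟨ cong (ℕ→ℚ L *_) (fromℤ-homo-* a z) ⟩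
    ℕ→ℚ L * fromℤ (a ℤ.* z)                     ∎)
    where
    open ≡-Reasoning
    swap : ∀ a l z → a * (l * z) ≡ l * (a * z)
    swap = solve-∀ ℚ-ring

  ∣[2^]-sub : ∀ {q r} → L ∣[2^ k ] q → L ∣[2^ k ] r → L ∣[2^ k ] (q - r)
  ∣[2^]-sub {r = r} L∣q L∣r =
    ∣[2^]-+ L∣q (subst (L ∣[2^ k ]_) (-1*≡neg r) (∣[2^]-* (isInteger‿- (isInteger-ℕ 1)) L∣r))
    where
    -1*≡neg : ∀ r → (- 1ℚ) * r ≡ - r
    -1*≡neg = solve-∀ ℚ-ring

  ∣[2^]-L* : ∀ {w} → IsInteger w → L ∣[2^ k ] (ℕ→ℚ L * w)
  ∣[2^]-L* {w} w∈ℤ with isInteger-* w∈ℤ (isInteger-^ (isInteger-ℕ 2) k)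
  ... | z , w2^k≡z = multiple z (trans (ℚP.*-assoc (ℕ→ℚ L) w _) (cong (ℕ→ℚ L *_) w2^k≡z))

  ∣[2^]-sum : ∀ n (f : ℕ → ℚ) → (∀ j → j < n → L ∣[2^ k ] f j) → L ∣[2^ k ] sumBelow n f
  ∣[2^]-sum zero f L∣f = ∣[2^]-0
  ∣[2^]-sum (suc n) f L∣f =
    ∣[2^]-+ (∣[2^]-sum n f (λ j j<n → L∣f j (ℕP.m<n⇒m<1+n j<n))) (L∣f n (ℕP.n<1+n n))

  ∣[2^]-halve : ∀ {q} → L ∣[2^ k ] (q * ℕ→ℚ 2) → L ∣[2^ suc k ] q
  ∣[2^]-halve {q} (multiple z 2q≡) = multiple z (trans (sym (ℚP.*-assoc q (ℕ→ℚ 2) _)) 2q≡)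

∣[2^]-weaken : ∀ {L k q} → L ∣[2^ k ] q → L ∣[2^ suc k ] q
∣[2^]-weaken {q = q} L∣q =
  ∣[2^]-halve (subst (_ ∣[2^ _ ]_) (ℚP.*-comm (ℕ→ℚ 2) q) (∣[2^]-* (isInteger-ℕ 2) L∣q))

∣[2^]-mono : ∀ {L k k′ q} → k ≤′ k′ → L ∣[2^ k ] q → L ∣[2^ k′ ] q
∣[2^]-mono ≤′-refl L∣q = L∣q
∣[2^]-mono (≤′-step k≤′k′) L∣q = ∣[2^]-weaken (∣[2^]-mono k≤′k′ L∣q)

∣[2^]-⊔ˡ : ∀ {L k q} l → L ∣[2^ k ] q → L ∣[2^ k ℕ.⊔ l ] q
∣[2^]-⊔ˡ {k = k} l = ∣[2^]-mono (ℕP.≤⇒≤′ (ℕP.m≤m⊔n k l))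

∣[2^]-⊔ʳ : ∀ {L l q} k → L ∣[2^ l ] q → L ∣[2^ k ℕ.⊔ l ] q
∣[2^]-⊔ʳ {l = l} k = ∣[2^]-mono (ℕP.≤⇒≤′ (ℕP.m≤n⊔m k l))

-- Euler numbers as limits of alternating power sums

module AltPowerSumError (E : ℕ → ℚ) (t : ℕ) where

  L : ℕ
  L = suc (t ℕ.* 2)

  error : ℕ → ℚ
  error j = altPowerSum L j - E j

  twice-error : ∀ m → error m * ℕ→ℚ 2 ≡
    (0ℚ ^ℚ m + ℕ→ℚ L ^ℚ m - eulerTransform E m) - sumBelow m (λ j → ℕ→ℚ (m C j) * error j)
  twice-error m = begin
    error m * ℕ→ℚ 2                                         ≡⟨ add-sub (error m * ℕ→ℚ 2) lower ⟩
    (lower + error m * ℕ→ℚ 2) - lower                       ≡⟨ cong (_- lower) (sym (eulerTransform-top error m)) ⟩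
    eulerTransform error m - lower                          ≡⟨ cong (_- lower) (eulerTransform-sub (altPowerSum L) E m) ⟩
    (eulerTransform (altPowerSum L) m - eulerTransform E m) - lower
      ≡⟨ cong (λ x → (x - eulerTransform E m) - lower) (eulerTransform-altPowerSum t m) ⟩
    (0ℚ ^ℚ m + ℕ→ℚ L ^ℚ m - eulerTransform E m) - lower     ∎
    where
    open ≡-Reasoning
    lower = sumBelow m (λ j → ℕ→ℚ (m C j) * error j)
    add-sub : ∀ x s → x ≡ (s + x) - s
    add-sub = solve-∀ ℚ-ring

  module _ (isEuler : IsEulerNumbers E) where

    error-step : ∀ m → (∀ j → j < m → L ∣[2^ m ] error j) → L ∣[2^ suc m ] error m
    error-step zero _ = ∣[2^]-halve (subst (L ∣[2^ 0 ]_) (sym twice-error₀) ∣[2^]-0)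
      where
      regroup : ∀ e → (1ℚ + 1ℚ - (0ℚ + 1ℚ * e + e)) - 0ℚ ≡ (1ℚ + 1ℚ) - (e + e)
      regroup = solve-∀ ℚ-ring
      twice-error₀ : error 0 * ℕ→ℚ 2 ≡ 0ℚ
      twice-error₀ = trans (twice-error 0)
        (trans (regroup (E 0)) (trans (cong (_-_ (1ℚ + 1ℚ)) (proj₁ isEuler)) (ℚP.+-inverseʳ (1ℚ + 1ℚ))))
    error-step (suc m) below =
      ∣[2^]-halve (subst (L ∣[2^ suc m ]_) (sym twice-errorₛ)
        (∣[2^]-sub (∣[2^]-L* (isInteger-^ (isInteger-ℕ L) m))
                   (∣[2^]-sum (suc m) _ (λ j j<m → ∣[2^]-* (isInteger-ℕ (suc m C j)) (below j j<m)))))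
      where
      lower = sumBelow (suc m) (λ j → ℕ→ℚ (suc m C j) * error j)
      drop-zeros : ∀ z y s → (0ℚ * z + y - 0ℚ) - s ≡ y - s
      drop-zeros = solve-∀ ℚ-ring
      twice-errorₛ : error (suc m) * ℕ→ℚ 2 ≡ ℕ→ℚ L * ℕ→ℚ L ^ℚ m - lower
      twice-errorₛ = trans (twice-error (suc m))
        (trans (cong (λ x → (0ℚ ^ℚ suc m + ℕ→ℚ L ^ℚ suc m - x) - lower) (proj₂ isEuler m))
          (drop-zeros (0ℚ ^ℚ m) (ℕ→ℚ L ^ℚ suc m) lower))

    errors-below : ∀ m j → j < m → L ∣[2^ m ] error j
    errors-below zero j ()
    errors-below (suc m) j j<1+m with ℕP.m<1+n⇒m<n∨m≡n j<1+m
    ... | inj₁ j<m = ∣[2^]-weaken (errors-below m j j<m)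
    ... | inj₂ refl = error-step m (errors-below m)

    error-divisible : ∀ m → L ∣[2^ suc m ] error m
    error-divisible m = error-step m (errors-below m)

-- A uniform version of the fermionic integral

Odd : ℕ → Set
Odd L = ∃[ t ] L ≡ suc (t ℕ.* 2)

-- Stronger than convergence along L = p^N for a single p; unlike that, it determines V uniquely.
HasIntegral : (ℕ → ℚ) → ℚ → Set
HasIntegral f V = ∃[ k ] ∀ L → Odd L → L ∣[2^ k ] (altSum f L - V)

hasIntegral-power : ∀ {E} → IsEulerNumbers E → ∀ m → HasIntegral (λ x → ℕ→ℚ x ^ℚ m) (E m)
hasIntegral-power {E} isEuler m = suc m , λ { _ (t , refl) → AltPowerSumError.error-divisible E t isEuler m }

hasIntegral-cong : ∀ {f g V} → f ≗ g → HasIntegral f V → HasIntegral g V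
hasIntegral-cong {V = V} f≗g (k , f→V) = k , λ L odd →
  subst (L ∣[2^ k ]_) (cong (_- V) (altSum-cong f≗g L)) (f→V L odd)

hasIntegral-0 : HasIntegral (λ _ → 0ℚ) 0ℚ
hasIntegral-0 = 0 , λ L _ → subst (L ∣[2^ 0 ]_) (sym (altSum-0 L)) ∣[2^]-0
  where
  altSum-0 : ∀ L → altSum (λ _ → 0ℚ) L - 0ℚ ≡ 0ℚ
  altSum-0 L = trans (ℚP.+-identityʳ _) (trans (sumBelow-cong L (λ x → ℚP.*-zeroʳ (sgn x))) (sumBelow-0 L))

hasIntegral-+ : ∀ {f g V W} → HasIntegral f V → HasIntegral g W → HasIntegral (λ x → f x + g x) (V + W)
hasIntegral-+ {f} {g} {V} {W} (k , f→V) (l , g→W) = k ℕ.⊔ l , λ L odd →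
  subst (L ∣[2^ k ℕ.⊔ l ]_) (regroup L)
    (∣[2^]-+ (∣[2^]-⊔ˡ l (f→V L odd)) (∣[2^]-⊔ʳ k (g→W L odd)))
  where
  interchange : ∀ a b v w → (a - v) + (b - w) ≡ (a + b) - (v + w)
  interchange = solve-∀ ℚ-ring
  regroup : ∀ L → (altSum f L - V) + (altSum g L - W) ≡ altSum (λ x → f x + g x) L - (V + W)
  regroup L = trans (interchange (altSum f L) (altSum g L) V W) (cong (_- (V + W)) (sym (altSum-+ f g L)))

hasIntegral-* : ∀ {c f V} → IsInteger c → HasIntegral f V → HasIntegral (λ x → c * f x) (c * V)
hasIntegral-* {c} {f} {V} c∈ℤ (k , f→V) = k , λ L odd →
  subst (L ∣[2^ k ]_) (distrib L) (∣[2^]-* c∈ℤ (f→V L odd))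
  where
  *-distrib-sub : ∀ c a v → c * (a - v) ≡ c * a - c * v
  *-distrib-sub = solve-∀ ℚ-ring
  distrib : ∀ L → c * (altSum f L - V) ≡ altSum (λ x → c * f x) L - c * V
  distrib L = trans (*-distrib-sub c (altSum f L) V) (cong (_- (c * V)) (sym (altSum-* c f L)))

hasIntegral-sum : ∀ n (f : ℕ → ℕ → ℚ) (V : ℕ → ℚ) → (∀ i → HasIntegral (f i) (V i)) →
  HasIntegral (λ x → sumBelow n (λ i → f i x)) (sumBelow n V)
hasIntegral-sum zero f V _ = hasIntegral-0
hasIntegral-sum (suc n) f V f→V = hasIntegral-+ (hasIntegral-sum n f V f→V) (f→V n)

hasIntegral-polynomial : ∀ {E} → IsEulerNumbers E →
  ∀ n (c : ℕ → ℚ) (d : ℕ → ℕ) → (∀ i → IsInteger (c i)) →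
  HasIntegral (λ x → sumBelow n (λ i → c i * ℕ→ℚ x ^ℚ d i)) (sumBelow n (λ i → c i * E (d i)))
hasIntegral-polynomial isEuler n c d c∈ℤ =
  hasIntegral-sum n _ _ (λ i → hasIntegral-* (c∈ℤ i) (hasIntegral-power isEuler (d i)))

multiple-<⇒≡0 : ∀ {n m} j → n ≡ m ℕ.* j → n < m → n ≡ 0
multiple-<⇒≡0 {m = m} zero n≡m*0 _ = trans n≡m*0 (ℕP.*-zeroʳ m)
multiple-<⇒≡0 {m = m} (suc j) refl m*[1+j]<m = ⊥-elim (ℕP.<⇒≱ m*[1+j]<m (ℕP.m≤m*n m (suc j)))

∣[2^]-allOdd⇒≡0 : ∀ {k q} → (∀ L → Odd L → L ∣[2^ k ] q) → q ≡ 0ℚ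
∣[2^]-allOdd⇒≡0 {k} {q} divisible = begin
  q                                 ≡⟨ sym (ℚP.*-identityʳ q) ⟩
  q * 1ℚ                            ≡⟨ cong (q *_) (sym (^ℚ-zeroˡ k)) ⟩
  q * (ℕ→ℚ 2 * ½) ^ℚ k              ≡⟨ cong (q *_) (^ℚ-distribʳ-* (ℕ→ℚ 2) ½ k) ⟩
  q * (ℕ→ℚ 2 ^ℚ k * ½ ^ℚ k)         ≡⟨ sym (ℚP.*-assoc q _ _) ⟩
  q * ℕ→ℚ 2 ^ℚ k * ½ ^ℚ k           ≡⟨ cong (_* ½ ^ℚ k) (trans c≡a (cong fromℤ a≡0)) ⟩
  0ℚ * ½ ^ℚ k                       ≡⟨ ℚP.*-zeroˡ (½ ^ℚ k) ⟩
  0ℚ                                ∎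
  where
  open ≡-Reasoning
  -- q 2^k is an integer a (take L = 1), which is divisible by L = 2|a| + 1 > |a|.
  open _∣[2^_]_ (divisible 1 (0 , refl)) renaming (quotient to a; equality to c≡1*a)
  c≡a : q * ℕ→ℚ 2 ^ℚ k ≡ fromℤ a
  c≡a = trans c≡1*a (ℚP.*-identityˡ (fromℤ a))
  L = suc (ℤ.∣ a ∣ ℕ.* 2)
  open _∣[2^_]_ (divisible L (ℤ.∣ a ∣ , refl)) renaming (quotient to b; equality to c≡L*b)
  a≡L*b : a ≡ + L ℤ.* b
  a≡L*b = fromℤ-injective (trans (sym c≡a) (trans c≡L*b (fromℤ-homo-* (+ L) b)))
  a≡0 : a ≡ + 0
  a≡0 = ℤP.∣i∣≡0⇒i≡0
    (multiple-<⇒≡0 ℤ.∣ b ∣ (trans (cong ℤ.∣_∣ a≡L*b) (ℤP.abs-* (+ L) b)) (s≤s (ℕP.m≤m*n ℤ.∣ a ∣ 2)))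

hasIntegral-unique : ∀ {f V W} → HasIntegral f V → HasIntegral f W → V ≡ W
hasIntegral-unique {f} {V} {W} (k , f→V) (l , f→W) =
  sym (x-y≡0⇒x≡y W V (∣[2^]-allOdd⇒≡0 (λ L odd → subst (L ∣[2^ k ℕ.⊔ l ]_) (cancel (altSum f L) V W)
    (∣[2^]-sub (∣[2^]-⊔ˡ l (f→V L odd)) (∣[2^]-⊔ʳ k (f→W L odd))))))
  where
  cancel : ∀ s v w → (s - v) - (s - w) ≡ w - v
  cancel = solve-∀ ℚ-ring

even-or-odd : ∀ n → (∃[ t ] n ≡ t ℕ.* 2) ⊎ Odd n
even-or-odd zero = inj₁ (0 , refl)
even-or-odd (suc n) with even-or-odd n
... | inj₁ (t , n≡2t) = inj₂ (t , cong suc n≡2t)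
... | inj₂ (t , n≡1+2t) = inj₁ (suc t , cong suc n≡1+2t)

odd-* : ∀ {a b} → Odd a → Odd b → Odd (a ℕ.* b)
odd-* (s , refl) (t , refl) = s ℕ.* suc (t ℕ.* 2) ℕ.+ t , sym (expand s t)
  where
  expand : ∀ s t → suc ((s ℕ.* suc (t ℕ.* 2) ℕ.+ t) ℕ.* 2) ≡ suc (s ℕ.* 2) ℕ.* suc (t ℕ.* 2)
  expand = ℕSolver.solve-∀

odd-^ : ∀ {a} → Odd a → ∀ N → Odd (a ℕ.^ N)
odd-^ _ zero = 0 , refl
odd-^ odd (suc N) = odd-* odd (odd-^ odd N)

prime≢2⇒odd : ∀ {p} → Prime p → p ≢ 2 → Odd p
prime≢2⇒odd {p} p-prime p≢2 with even-or-odd p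
... | inj₂ odd = odd
... | inj₁ (t , p≡2t) with prime⇒irreducible p-prime (divides t p≡2t)
... | inj₁ ()
... | inj₂ 2≡p = ⊥-elim (p≢2 (sym 2≡p))

prime≢2⇒∤2^ : ∀ {p} → Prime p → p ≢ 2 → ∀ K → ¬ p ℕD.∣ 2 ℕ.^ K
prime≢2⇒∤2^ p-prime p≢2 zero p∣1 = ℕ.nonTrivial⇒≢1 {{prime⇒nonTrivial p-prime}} (ℕD.∣1⇒≡1 p∣1)
prime≢2⇒∤2^ {p} p-prime p≢2 (suc K) p∣2^[1+K] =
  prime≢2⇒∤2^ p-prime p≢2 K (Coprime.coprime-divisor coprime[p,2] p∣2^[1+K])
  where
  coprime[p,2] : Coprime.Coprime p 2
  coprime[p,2] = prime⇒coprime p-prime (ℕP.≤∧≢⇒< (ℕ.nonTrivial⇒n>1 p {{prime⇒nonTrivial p-prime}}) (p≢2 ∘ sym))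

hasIntegral⇒fermionic : ∀ {p f V} → Prime p → p ≢ 2 → HasIntegral f V → FermionicIntegral p f V
hasIntegral⇒fermionic {p} {f} {V} p-prime p≢2 (k , f→V) M = M , small
  where
  small : ∀ N → M ≤ N → PAdicSmall p M (altSum f (p ℕ.^ N) - V)
  small N M≤N with f→V (p ℕ.^ N) (odd-^ (prime≢2⇒odd p-prime p≢2) N)
  ... | multiple z eq = + (p ℕ.^ (N ∸ M)) ℤ.* z , + (2 ℕ.^ k) , prime≢2⇒∤2^ p-prime p≢2 k , (begin
    q * ℕ→ℚ (2 ℕ.^ k)                               ≡⟨ cong (q *_) (ℕ→ℚ-homo-^ 2 k) ⟩
    q * ℕ→ℚ 2 ^ℚ k                                  ≡⟨ eq ⟩
    ℕ→ℚ (p ℕ.^ N) * fromℤ z                         ≡⟨ cong (_* fromℤ z) p^N≡ ⟩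
    ℕ→ℚ (p ℕ.^ M) * ℕ→ℚ (p ℕ.^ (N ∸ M)) * fromℤ z   ≡⟨ ℚP.*-assoc (ℕ→ℚ (p ℕ.^ M)) _ _ ⟩
    ℕ→ℚ (p ℕ.^ M) * (ℕ→ℚ (p ℕ.^ (N ∸ M)) * fromℤ z)
      ≡⟨ cong (ℕ→ℚ (p ℕ.^ M) *_) (fromℤ-homo-* (+ (p ℕ.^ (N ∸ M))) z) ⟩
    ℕ→ℚ (p ℕ.^ M) * fromℤ (+ (p ℕ.^ (N ∸ M)) ℤ.* z) ∎)
    where
    open ≡-Reasoning
    q = altSum f (p ℕ.^ N) - V
    p^N≡ : ℕ→ℚ (p ℕ.^ N) ≡ ℕ→ℚ (p ℕ.^ M) * ℕ→ℚ (p ℕ.^ (N ∸ M))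
    p^N≡ = trans (cong (λ e → ℕ→ℚ (p ℕ.^ e)) (sym (ℕP.m+[n∸m]≡n M≤N)))
      (trans (cong ℕ→ℚ (ℕP.^-distribˡ-+-* p M (N ∸ M))) (ℕ→ℚ-homo-* (p ℕ.^ M) (p ℕ.^ (N ∸ M))))

bernsteinCoeff : ℕ → ℕ → ℕ → ℚ
bernsteinCoeff n k i = ℕ→ℚ (n C k) * ℕ→ℚ ((n ∸ k) C i) * sgn i

bernstein-expansion : ∀ n k x → bernstein k n x ≡ sumTo (n ∸ k) (λ i → bernsteinCoeff n k i * x ^ℚ (k ℕ.+ i))
bernstein-expansion n k x = begin
  c * x ^ℚ k * (1ℚ - x) ^ℚ r
    ≡⟨ cong (λ y → c * x ^ℚ k * y ^ℚ r) (ℚP.+-comm 1ℚ (- x)) ⟩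
  c * x ^ℚ k * (- x + 1ℚ) ^ℚ r
    ≡⟨ cong (c * x ^ℚ k *_) (binomial (- x) 1ℚ r) ⟩
  c * x ^ℚ k * sumTo r (λ i → ℕ→ℚ (r C i) * (- x) ^ℚ i * 1ℚ ^ℚ (r ∸ i))
    ≡⟨ sym (sumBelow-* (suc r) (c * x ^ℚ k) _) ⟩
  sumTo r (λ i → c * x ^ℚ k * (ℕ→ℚ (r C i) * (- x) ^ℚ i * 1ℚ ^ℚ (r ∸ i)))
    ≡⟨ sumBelow-cong (suc r) term ⟩
  sumTo r (λ i → bernsteinCoeff n k i * x ^ℚ (k ℕ.+ i)) ∎
  where
  open ≡-Reasoning
  c = ℕ→ℚ (n C k)
  r = n ∸ k
  regroup : ∀ c y d s z → c * y * (d * (s * z) * 1ℚ) ≡ c * d * s * (y * z)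
  regroup = solve-∀ ℚ-ring
  term : ∀ i → c * x ^ℚ k * (ℕ→ℚ (r C i) * (- x) ^ℚ i * 1ℚ ^ℚ (r ∸ i))
             ≡ bernsteinCoeff n k i * x ^ℚ (k ℕ.+ i)
  term i = begin
    c * x ^ℚ k * (ℕ→ℚ (r C i) * (- x) ^ℚ i * 1ℚ ^ℚ (r ∸ i))
      ≡⟨ cong₂ (λ u v → c * x ^ℚ k * (ℕ→ℚ (r C i) * u * v)) (neg-^ℚ x i) (^ℚ-zeroˡ (r ∸ i)) ⟩
    c * x ^ℚ k * (ℕ→ℚ (r C i) * (sgn i * x ^ℚ i) * 1ℚ)
      ≡⟨ regroup c (x ^ℚ k) (ℕ→ℚ (r C i)) (sgn i) (x ^ℚ i) ⟩
    bernsteinCoeff n k i * (x ^ℚ k * x ^ℚ i)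
      ≡⟨ cong (bernsteinCoeff n k i *_) (sym (^ℚ-distribˡ-+-* x k i)) ⟩
    bernsteinCoeff n k i * x ^ℚ (k ℕ.+ i) ∎

alternating-bernstein : ∀ n x →
  sumTo n (λ k → sgn k * bernstein k n x)
    ≡ sumTo n (λ j → ℕ→ℚ (n C j) * (- (1ℚ + 1ℚ)) ^ℚ (n ∸ j) * x ^ℚ (n ∸ j))
alternating-bernstein n x = begin
  sumTo n (λ k → sgn k * bernstein k n x)
    ≡⟨ sumBelow-cong (suc n) signed-term ⟩
  sumTo n (λ k → ℕ→ℚ (n C k) * (- x) ^ℚ k * (1ℚ - x) ^ℚ (n ∸ k))
    ≡⟨ sym (binomial (- x) (1ℚ - x) n) ⟩
  (- x + (1ℚ - x)) ^ℚ n
    ≡⟨ cong (_^ℚ n) (collect x) ⟩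
  (1ℚ + - (1ℚ + 1ℚ) * x) ^ℚ n
    ≡⟨ binomial 1ℚ (- (1ℚ + 1ℚ) * x) n ⟩
  sumTo n (λ j → ℕ→ℚ (n C j) * 1ℚ ^ℚ j * (- (1ℚ + 1ℚ) * x) ^ℚ (n ∸ j))
    ≡⟨ sumBelow-cong (suc n) power-term ⟩
  sumTo n (λ j → ℕ→ℚ (n C j) * (- (1ℚ + 1ℚ)) ^ℚ (n ∸ j) * x ^ℚ (n ∸ j)) ∎
  where
  open ≡-Reasoning
  collect : ∀ x → - x + (1ℚ - x) ≡ 1ℚ + - (1ℚ + 1ℚ) * x
  collect = solve-∀ ℚ-ring
  regroup : ∀ s c a b → s * (c * a * b) ≡ c * (s * a) * b
  regroup = solve-∀ ℚ-ring
  drop-1 : ∀ c a b → c * 1ℚ * (a * b) ≡ c * a * b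
  drop-1 = solve-∀ ℚ-ring
  signed-term : ∀ k → sgn k * bernstein k n x ≡ ℕ→ℚ (n C k) * (- x) ^ℚ k * (1ℚ - x) ^ℚ (n ∸ k)
  signed-term k = trans (regroup (sgn k) (ℕ→ℚ (n C k)) (x ^ℚ k) ((1ℚ - x) ^ℚ (n ∸ k)))
    (cong (λ y → ℕ→ℚ (n C k) * y * (1ℚ - x) ^ℚ (n ∸ k)) (sym (neg-^ℚ x k)))
  power-term : ∀ j → ℕ→ℚ (n C j) * 1ℚ ^ℚ j * (- (1ℚ + 1ℚ) * x) ^ℚ (n ∸ j)
                   ≡ ℕ→ℚ (n C j) * (- (1ℚ + 1ℚ)) ^ℚ (n ∸ j) * x ^ℚ (n ∸ j)
  power-term j =
    trans (cong₂ (λ u v → ℕ→ℚ (n C j) * u * v) (^ℚ-zeroˡ j) (^ℚ-distribʳ-* (- (1ℚ + 1ℚ)) x (n ∸ j)))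
    (drop-1 (ℕ→ℚ (n C j)) ((- (1ℚ + 1ℚ)) ^ℚ (n ∸ j)) (x ^ℚ (n ∸ j)))

bernsteinIntegral : (ℕ → ℚ) → ℕ → ℕ → ℚ
bernsteinIntegral E n k = sumTo (n ∸ k) (λ i → bernsteinCoeff n k i * E (k ℕ.+ i))

hasIntegral-bernstein : ∀ {E} → IsEulerNumbers E → ∀ n k →
  HasIntegral (λ x → bernstein k n (ℕ→ℚ x)) (bernsteinIntegral E n k)
hasIntegral-bernstein isEuler n k =
  hasIntegral-cong (λ x → sym (bernstein-expansion n k (ℕ→ℚ x)))
    (hasIntegral-polynomial isEuler (suc (n ∸ k)) (bernsteinCoeff n k) (k ℕ.+_)
      (λ i → isInteger-* (isInteger-* (isInteger-ℕ (n C k)) (isInteger-ℕ ((n ∸ k) C i))) (isInteger-sgn i)))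

mainTheorem16 : (p : ℕ) → Prime p → p ≢ 2 →
    (E : ℕ → ℚ) → IsEulerNumbers E →
    (n : ℕ) →
      Σ (ℕ → ℚ) λ I → ((∀ k → k ≤ n → FermionicIntegral p (λ x → bernstein k n (ℕ→ℚ x)) (I k)) ×
        (sumTo n (λ k → sgn k * I k)
          ≡ sumTo n (λ j → ℕ→ℚ (n C j) * ((- (1ℚ + 1ℚ)) ^ℚ (n ∸ j)) * E (n ∸ j))))
mainTheorem16 p p-prime p≢2 E isEuler n =
  bernsteinIntegral E n , (λ k _ → hasIntegral⇒fermionic p-prime p≢2 (hasIntegral-bernstein isEuler n k)) ,
  hasIntegral-unique
    (hasIntegral-cong (alternating-bernstein n ∘ ℕ→ℚ)
      (hasIntegral-sum (suc n) _ _ (λ k → hasIntegral-* (isInteger-sgn k) (hasIntegral-bernstein isEuler n k))))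
    (hasIntegral-polynomial isEuler (suc n) (λ j → ℕ→ℚ (n C j) * (- (1ℚ + 1ℚ)) ^ℚ (n ∸ j)) (n ∸_)
      (λ j → isInteger-* (isInteger-ℕ (n C j)) (isInteger-^ (isInteger‿- (isInteger-ℕ 2)) (n ∸ j))))
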